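{- Let $n\ge1$ and write $a_n(x)=\sum_{k=0}^n b(n,k)(x-1)^k$. Then for $0\le k\le n$, $$b(n,k)=\frac{k+1}{n+1}\binom{2n-k}{n}.$$
   Context: $a_n(x)=\sum_{\pi\in S_n(321)}x^{f(\pi)}$, where $S_n(321)$ is the set of permutations $\pi=\pi_1\cdots\pi_n$ of $\{1,\dots,n\}$ with no indices $i<j<l$ such that $\pi_i>\pi_j>\pi_l$, and $f(\pi)$ is the number of indices $i$ with $\pi_i=i$. -}

module Defs where

open import Data.Nat using (ℕ; zero; suc; _∸_; _<ᵇ_; _≡ᵇ_)
open import Data.Nat.Combinatorics using (_C_)
open import Data.Fin using (Fin; toℕ)
open import Data.Vec using (Vec; []; _∷_; lookup)
open import Data.List using (List; []; _∷_; map; concatMap; filterᵇ; foldr; allFin; upTo; length)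
open import Data.Bool.ListAction using (all; any)
open import Data.Bool using (Bool; true; false; _∧_; not; if_then_else_)
open import Data.Integer using (ℤ; +_; _-_; _*_; _^_)
import Data.Integer as ℤ

sumℤ : List ℤ → ℤ
sumℤ = foldr ℤ._+_ (+ 0)

allVecs : (m n : ℕ) → List (Vec (Fin m) n)
allVecs m zero = [] ∷ []
allVecs m (suc n) = concatMap (λ a → map (a ∷_) (allVecs m n)) (allFin m)

val : ∀ {n} → Vec (Fin n) n → Fin n → ℕ
val π i = toℕ (lookup π i)

isPerm : ∀ {n} → Vec (Fin n) n → Bool
isPerm {n} π = all (λ i → all (λ j → not ((toℕ i <ᵇ toℕ j) ∧ (val π i ≡ᵇ val π j))) (allFin n)) (allFin n)

has321 : ∀ {n} → Vec (Fin n) n → Bool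
has321 {n} π = any (λ i → any (λ j → any (λ l →
  (toℕ i <ᵇ toℕ j) ∧ (toℕ j <ᵇ toℕ l) ∧ (val π j <ᵇ val π i) ∧ (val π l <ᵇ val π j))
  (allFin n)) (allFin n)) (allFin n)

S321 : (n : ℕ) → List (Vec (Fin n) n)
S321 n = filterᵇ (λ π → isPerm π ∧ not (has321 π)) (allVecs n n)

fix : ∀ {n} → Vec (Fin n) n → ℕ
fix {n} π = length (filterᵇ (λ i → val π i ≡ᵇ toℕ i) (allFin n))

a : ℕ → ℤ → ℤ
a n x = sumℤ (map (λ π → x ^ fix π) (S321 n))

-- Refine a by a threshold t: aₜ t n x sums x ^ (number of fixed points i ≥ t) over the
-- 321-avoiding permutations of {0, …, n − 1} whose values below t occur in increasing order;
-- a n x = aₜ 0 n x.  Split a permutation into its first letter b and the rest, standardised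
-- around b.  For b = 0 the rest contributes aₜ (t ∸ 1) m x (times x when t = 0); for b ≥ 1 it
-- contributes aₜ b m x when t ≤ b and nothing when b < t, since the later letter 0 then forms
-- an inversion with b below t.  With y = x − 1 this gives
--   aₜ m m = 1,   aₜ 0 (m+1) = aₜ 1 (m+1) + y · aₜ 0 m,
--   aₜ (t+1) (m+1) = aₜ (t+2) (m+1) + aₜ t m   for t < m,
-- the Pascal-type recurrences solved by Σ_{d ≤ m−t} ballot m (m − t − d) · y ^ d, where
-- ballot m e = C(m+e, m) − C(m+e, m+1).  Finally (n+1) · ballot n (n − k) = (k+1) · C(2n−k, n).

module Submission where

open import Defs
open import Data.Nat using (ℕ; suc; _≤_; _∸_)
import Data.Nat
open import Data.Nat.Combinatorics using (_C_)
open import Data.Integer using (ℤ; +_; _-_; _*_; _^_)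
open import Data.List using (map; upTo)
open import Relation.Binary.PropositionalEquality using (_≡_)

open import Data.Bool using (Bool; true; false; T; _∧_; not; if_then_else_)
open import Data.Bool.ListAction using (all; any)
open import Data.Bool.Properties using (∧-identityʳ)
open import Data.Empty using (⊥-elim)
open import Data.Fin as Fin using (Fin; zero; suc; toℕ; punchIn; punchOut)
import Data.Fin.Properties as Fin
open import Data.Integer using (_+_)
import Data.Integer.Properties as ℤ
open import Data.Integer.Tactic.RingSolver using (solve-∀)
open import Data.List as List using (List; []; _∷_; _++_; applyUpTo; tabulate; concatMap; filterᵇ; allFin)
import Data.List.Properties as List
import Data.List.Relation.Unary.All.Properties as All
import Data.List.Relation.Unary.Any.Properties as Any
open import Data.Nat as ℕ using (zero; z≤n; s≤s; _<_; _<ᵇ_; _≡ᵇ_)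
import Data.Nat.Properties as ℕ
open import Data.Nat.Combinatorics
  using (nCk+nC[k+1]≡[n+1]C[k+1]; k>n⇒nCk≡0; nCn≡1; nC1≡n; nCk≡nC[n∸k])
open import Data.Product using (∃; _×_; _,_; proj₁; proj₂)
open import Data.Sum using (_⊎_; inj₁; inj₂; [_,_])
open import Data.Vec as Vec using (Vec; lookup; _∷_)
import Data.Vec.Properties as Vec
open import Function using (_∘_; id; const; _⇔_; mk⇔; Equivalence)
open import Function.Construct.Composition using (_⇔-∘_)
open import Function.Construct.Symmetry using (⇔-sym)
open import Function.Definitions using (Injective)
open import Relation.Binary.Definitions using (tri<; tri≈; tri>)
open import Relation.Binary.PropositionalEquality
  using (_≢_; _≗_; refl; sym; trans; cong; cong₂; subst; subst₂; module ≡-Reasoning)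
open import Relation.Nullary using (¬_; Dec; yes; no; does; ¬?; _×-dec_)
open import Relation.Nullary.Decidable using (T?; does-⇔)
open import Algebra.Properties.Semiring.Sum ℤ.+-*-semiring
  using (sum; sum-syntax; sum-cong-≗; *-distribˡ-sum; sum-remove)

open ≡-Reasoning

sumℤ-++ : ∀ xs ys → sumℤ (xs ++ ys) ≡ sumℤ xs + sumℤ ys
sumℤ-++ []       ys = sym (ℤ.+-identityˡ (sumℤ ys))
sumℤ-++ (x ∷ xs) ys = trans (cong (_+_ x) (sumℤ-++ xs ys)) (sym (ℤ.+-assoc x (sumℤ xs) (sumℤ ys)))

sumℤ-map-applyUpTo : ∀ (f : ℕ → ℤ) g n → sumℤ (map f (applyUpTo g n)) ≡ ∑[ k < n ] f (g (toℕ k))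
sumℤ-map-applyUpTo f g zero    = refl
sumℤ-map-applyUpTo f g (suc n) = cong (_+_ (f (g 0))) (sumℤ-map-applyUpTo f (g ∘ suc) n)

sumℤ-map-concatMap : ∀ {A B : Set} (g : B → ℤ) (h : A → List B) xs →
  sumℤ (map g (concatMap h xs)) ≡ sumℤ (map (λ a → sumℤ (map g (h a))) xs)
sumℤ-map-concatMap g h []       = refl
sumℤ-map-concatMap g h (x ∷ xs) = begin
  sumℤ (map g (h x ++ concatMap h xs))
    ≡⟨ cong sumℤ (List.map-++ g (h x) (concatMap h xs)) ⟩
  sumℤ (map g (h x) ++ map g (concatMap h xs))
    ≡⟨ sumℤ-++ (map g (h x)) (map g (concatMap h xs)) ⟩
  sumℤ (map g (h x)) + sumℤ (map g (concatMap h xs))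
    ≡⟨ cong (_+_ (sumℤ (map g (h x)))) (sumℤ-map-concatMap g h xs) ⟩
  sumℤ (map (λ a → sumℤ (map g (h a))) (x ∷ xs)) ∎

sumℤ-map-tabulate : ∀ {A : Set} {n} (g : A → ℤ) (f : Fin n → A) →
  sumℤ (map g (tabulate f)) ≡ ∑[ i < n ] g (f i)
sumℤ-map-tabulate {n = zero}  g f = refl
sumℤ-map-tabulate {n = suc n} g f = cong (_+_ (g (f zero))) (sumℤ-map-tabulate g (f ∘ suc))

sumℤ-map-zero : ∀ {A : Set} {g : A → ℤ} xs → (∀ a → g a ≡ + 0) → sumℤ (map g xs) ≡ + 0
sumℤ-map-zero []       g≡0 = refl
sumℤ-map-zero (x ∷ xs) g≡0 = cong₂ _+_ (g≡0 x) (sumℤ-map-zero xs g≡0)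

sumℤ-map-scale : ∀ {A : Set} (c : ℤ) (g : A → ℤ) xs →
  sumℤ (map (λ a → c * g a) xs) ≡ c * sumℤ (map g xs)
sumℤ-map-scale c g []       = sym (ℤ.*-zeroʳ c)
sumℤ-map-scale c g (x ∷ xs) =
  trans (cong (_+_ (c * g x)) (sumℤ-map-scale c g xs)) (sym (ℤ.*-distribˡ-+ c (g x) (sumℤ (map g xs))))

sumℤ-map-filterᵇ : ∀ {A : Set} (p : A → Bool) (g : A → ℤ) xs →
  sumℤ (map g (filterᵇ p xs)) ≡ sumℤ (map (λ a → if p a then g a else + 0) xs)
sumℤ-map-filterᵇ p g []       = refl
sumℤ-map-filterᵇ p g (x ∷ xs) with p x
... | true  = cong (_+_ (g x)) (sumℤ-map-filterᵇ p g xs)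
... | false = trans (sumℤ-map-filterᵇ p g xs) (sym (ℤ.+-identityˡ _))

[k+1]*[n+1]C[k+1]≡[n+1]*nCk : ∀ n k → suc k ℕ.* (suc n C suc k) ≡ suc n ℕ.* (n C k)
[k+1]*[n+1]C[k+1]≡[n+1]*nCk n zero = begin
  1 ℕ.* (suc n C 1)  ≡⟨ ℕ.*-identityˡ _ ⟩
  suc n C 1          ≡⟨ nC1≡n (suc n) ⟩
  suc n              ≡⟨ ℕ.*-identityʳ (suc n) ⟨
  suc n ℕ.* (n C 0)  ∎
[k+1]*[n+1]C[k+1]≡[n+1]*nCk zero (suc k) = ℕ.*-zeroʳ (suc (suc k))
[k+1]*[n+1]C[k+1]≡[n+1]*nCk (suc n) (suc k) = begin
  suc (suc k) ℕ.* (suc (suc n) C suc (suc k))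
    ≡⟨ cong (suc (suc k) ℕ.*_) (nCk+nC[k+1]≡[n+1]C[k+1] (suc n) (suc k)) ⟨
  suc (suc k) ℕ.* (X ℕ.+ Y)
    ≡⟨ ℕ.*-distribˡ-+ (suc (suc k)) X Y ⟩
  (X ℕ.+ suc k ℕ.* X) ℕ.+ suc (suc k) ℕ.* Y
    ≡⟨ cong₂ (λ u v → (X ℕ.+ u) ℕ.+ v)
             ([k+1]*[n+1]C[k+1]≡[n+1]*nCk n k) ([k+1]*[n+1]C[k+1]≡[n+1]*nCk n (suc k)) ⟩
  (X ℕ.+ suc n ℕ.* (n C k)) ℕ.+ suc n ℕ.* (n C suc k)
    ≡⟨ ℕ.+-assoc X _ _ ⟩
  X ℕ.+ (suc n ℕ.* (n C k) ℕ.+ suc n ℕ.* (n C suc k))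
    ≡⟨ cong (X ℕ.+_) (ℕ.*-distribˡ-+ (suc n) (n C k) (n C suc k)) ⟨
  X ℕ.+ suc n ℕ.* (n C k ℕ.+ n C suc k)
    ≡⟨ cong (λ u → X ℕ.+ suc n ℕ.* u) (nCk+nC[k+1]≡[n+1]C[k+1] n k) ⟩
  suc (suc n) ℕ.* X ∎
  where
    X = suc n C suc k
    Y = suc n C suc (suc k)

[k+1]*[k+e]C[k+1]≡e*[k+e]Ck : ∀ k e → suc k ℕ.* ((k ℕ.+ e) C suc k) ≡ e ℕ.* ((k ℕ.+ e) C k)
[k+1]*[k+e]C[k+1]≡e*[k+e]Ck k e = ℕ.+-cancelˡ-≡ (suc k ℕ.* X) _ _ (begin
  suc k ℕ.* X ℕ.+ suc k ℕ.* (N C suc k)  ≡⟨ ℕ.*-distribˡ-+ (suc k) X _ ⟨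
  suc k ℕ.* (X ℕ.+ N C suc k)            ≡⟨ cong (suc k ℕ.*_) (nCk+nC[k+1]≡[n+1]C[k+1] N k) ⟩
  suc k ℕ.* (suc N C suc k)              ≡⟨ [k+1]*[n+1]C[k+1]≡[n+1]*nCk N k ⟩
  (suc k ℕ.+ e) ℕ.* X                    ≡⟨ ℕ.*-distribʳ-+ X (suc k) e ⟩
  suc k ℕ.* X ℕ.+ e ℕ.* X                ∎)
  where
    N = k ℕ.+ e
    X = N C k

ballot : ℕ → ℕ → ℤ
ballot m e = + ((m ℕ.+ e) C m) - + ((m ℕ.+ e) C suc m)

ballot-zero : ∀ m → ballot m 0 ≡ + 1
ballot-zero m rewrite ℕ.+-identityʳ m | nCn≡1 m | k>n⇒nCk≡0 (ℕ.n<1+n m) = refl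

ballot-pascal : ∀ m e → ballot (suc m) (suc e) ≡ ballot (suc m) e + ballot m (suc e)
ballot-pascal m e = begin
  + (suc (m ℕ.+ suc e) C suc m) - + (suc (m ℕ.+ suc e) C suc (suc m))
    ≡⟨ cong (λ z → + (suc z C suc m) - + (suc z C suc (suc m))) (ℕ.+-suc m e) ⟩
  + (suc N C suc m) - + (suc N C suc (suc m))
    ≡⟨ cong₂ (λ u v → + u - + v)
             (sym (nCk+nC[k+1]≡[n+1]C[k+1] N m)) (sym (nCk+nC[k+1]≡[n+1]C[k+1] N (suc m))) ⟩
  + (N C m ℕ.+ N C suc m) - + (N C suc m ℕ.+ N C suc (suc m))
    ≡⟨ cong₂ _-_ (ℤ.pos-+ (N C m) _) (ℤ.pos-+ (N C suc m) _) ⟩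
  (+ (N C m) + + (N C suc m)) - (+ (N C suc m) + + (N C suc (suc m)))
    ≡⟨ pascal-difference (+ (N C m)) (+ (N C suc m)) (+ (N C suc (suc m))) ⟩
  ballot (suc m) e + (+ (N C m) - + (N C suc m))
    ≡⟨ cong (λ z → ballot (suc m) e + (+ (z C m) - + (z C suc m))) (ℕ.+-suc m e) ⟨
  ballot (suc m) e + ballot m (suc e) ∎
  where
    N = suc (m ℕ.+ e)
    pascal-difference : ∀ (a b c : ℤ) → (a + b) - (b + c) ≡ (b - c) + (a - b)
    pascal-difference = solve-∀

ballot-beyond : ∀ m → ballot m (suc m) ≡ + 0
ballot-beyond m = begin
  + (N C m) - + (N C suc m)  ≡⟨ cong (λ k → + (N C m) - + (N C k)) (ℕ.m+n∸m≡n m (suc m)) ⟨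
  + (N C m) - + (N C (N ∸ m)) ≡⟨ cong (λ k → + (N C m) - + k) (nCk≡nC[n∸k] (ℕ.m≤m+n m (suc m))) ⟨
  + (N C m) - + (N C m)      ≡⟨ ℤ.+-inverseʳ (+ (N C m)) ⟩
  + 0                        ∎
  where N = m ℕ.+ suc m

ballot-closed : ∀ {k e n} → k ℕ.+ e ≡ n → + suc n * ballot n e ≡ + (suc k ℕ.* ((n ℕ.+ e) C n))
ballot-closed {k} {e} refl = begin
  + suc n * (+ X - + Y)              ≡⟨ *-distribˡ-- (+ suc n) (+ X) (+ Y) ⟩
  + suc n * + X - + suc n * + Y      ≡⟨ cong (λ z → + suc n * + X - z) upper ⟩
  + suc n * + X - + e * + X          ≡⟨ cong (λ z → z * + X - + e * + X) (ℤ.pos-+ (suc k) e) ⟩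
  (+ suc k + + e) * + X - + e * + X  ≡⟨ cancel-e (+ suc k) (+ e) (+ X) ⟩
  + suc k * + X                      ≡⟨ ℤ.pos-* (suc k) X ⟨
  + (suc k ℕ.* X)                    ∎
  where
    n = k ℕ.+ e
    X = (n ℕ.+ e) C n
    Y = (n ℕ.+ e) C suc n
    upper : + suc n * + Y ≡ + e * + X
    upper = begin
      + suc n * + Y     ≡⟨ ℤ.pos-* (suc n) Y ⟨
      + (suc n ℕ.* Y)   ≡⟨ cong +_ ([k+1]*[k+e]C[k+1]≡e*[k+e]Ck n e) ⟩
      + (e ℕ.* X)       ≡⟨ ℤ.pos-* e X ⟩
      + e * + X         ∎
    *-distribˡ-- : ∀ (a b c : ℤ) → a * (b - c) ≡ a * b - a * c
    *-distribˡ-- = solve-∀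
    cancel-e : ∀ (a b c : ℤ) → (a + b) * c - b * c ≡ a * c
    cancel-e = solve-∀

ballotPoly : ℤ → ℕ → ℕ → ℤ
ballotPoly y m zero    = ballot m zero
ballotPoly y m (suc e) = ballot m (suc e) + y * ballotPoly y m e

ballotPoly-pascal : ∀ y m e → ballotPoly y (suc m) (suc e) ≡ ballotPoly y (suc m) e + ballotPoly y m (suc e)
ballotPoly-pascal y m zero
  rewrite ballot-pascal m 0 | ballot-zero m | ballot-zero (suc m) = regroup y (+ 1) (ballot m 1)
  where
    regroup : ∀ y a b → (a + b) + y * a ≡ a + (b + y * a)
    regroup = solve-∀
ballotPoly-pascal y m (suc e) = begin
  ballot (suc m) (suc (suc e)) + y * ballotPoly y (suc m) (suc e)
    ≡⟨ cong₂ (λ u v → u + y * v) (ballot-pascal m (suc e)) (ballotPoly-pascal y m e) ⟩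
  (ballot (suc m) (suc e) + ballot m (suc (suc e))) + y * (ballotPoly y (suc m) e + ballotPoly y m (suc e))
    ≡⟨ regroup y (ballot (suc m) (suc e)) (ballot m (suc (suc e))) (ballotPoly y (suc m) e) (ballotPoly y m (suc e)) ⟩
  ballotPoly y (suc m) (suc e) + ballotPoly y m (suc (suc e)) ∎
  where
    regroup : ∀ y a b c d → (a + b) + y * (c + d) ≡ (a + y * c) + (b + y * d)
    regroup = solve-∀

ballotPoly-beyond : ∀ y m → ballotPoly y m (suc m) ≡ y * ballotPoly y m m
ballotPoly-beyond y m rewrite ballot-beyond m = ℤ.+-identityˡ _

module _ (y : ℤ) (f : ℕ → ℕ → ℤ)
         (f-diag : ∀ m → f m m ≡ + 1)
         (f-rec₀ : ∀ m → f (suc m) 0 ≡ f (suc m) 1 + y * f m 0)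
         (f-rec : ∀ {m t} → t < m → f (suc m) (suc t) ≡ f (suc m) (suc (suc t)) + f m t)
         where

  ballotPoly-unique : ∀ m e t → t ℕ.+ e ≡ m → f m t ≡ ballotPoly y m e
  ballotPoly-unique m zero t refl rewrite ℕ.+-identityʳ t = trans (f-diag t) (sym (ballot-zero t))
  ballotPoly-unique (suc m) (suc .m) zero refl = begin
    f (suc m) 0
      ≡⟨ f-rec₀ m ⟩
    f (suc m) 1 + y * f m 0
      ≡⟨ cong₂ (λ u v → u + y * v) (ballotPoly-unique (suc m) m 1 refl) (ballotPoly-unique m m 0 refl) ⟩
    ballotPoly y (suc m) m + y * ballotPoly y m m
      ≡⟨ cong (λ z → ballotPoly y (suc m) m + z) (ballotPoly-beyond y m) ⟨
    ballotPoly y (suc m) m + ballotPoly y m (suc m)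
      ≡⟨ ballotPoly-pascal y m m ⟨
    ballotPoly y (suc m) (suc m) ∎
  ballotPoly-unique (suc m) (suc e) (suc t) t+e≡m = begin
    f (suc m) (suc t)
      ≡⟨ f-rec t<m ⟩
    f (suc m) (suc (suc t)) + f m t
      ≡⟨ cong₂ _+_ (ballotPoly-unique (suc m) e (suc (suc t)) (trans (cong suc (sym (ℕ.+-suc t e))) t+e≡m))
                   (ballotPoly-unique m (suc e) t (ℕ.suc-injective t+e≡m)) ⟩
    ballotPoly y (suc m) e + ballotPoly y m (suc e)
      ≡⟨ ballotPoly-pascal y m e ⟨
    ballotPoly y (suc m) (suc e) ∎
    where
      t<m : t < m
      t<m = subst (t <_) (ℕ.suc-injective t+e≡m) (ℕ.m<m+n t (s≤s z≤n))

ballotPoly-expansion : ∀ y m e → ballotPoly y m e ≡ ∑[ d < suc e ] (ballot m (e ∸ toℕ d) * y ^ toℕ d)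
ballotPoly-expansion y m zero = sym (trans (ℤ.+-identityʳ _) (ℤ.*-identityʳ (ballot m 0)))
ballotPoly-expansion y m (suc e) = cong₂ _+_ (sym (ℤ.*-identityʳ (ballot m (suc e)))) (begin
  y * ballotPoly y m e
    ≡⟨ cong (y *_) (ballotPoly-expansion y m e) ⟩
  y * ∑[ d < suc e ] (ballot m (e ∸ toℕ d) * y ^ toℕ d)
    ≡⟨ *-distribˡ-sum {suc e} y (λ d → ballot m (e ∸ toℕ d) * y ^ toℕ d) ⟩
  ∑[ d < suc e ] (y * (ballot m (e ∸ toℕ d) * y ^ toℕ d))
    ≡⟨ sum-cong-≗ {suc e} (λ d → swap y (ballot m (e ∸ toℕ d)) (y ^ toℕ d)) ⟩
  ∑[ d < suc e ] (ballot m (e ∸ toℕ d) * (y * y ^ toℕ d)) ∎)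
  where
    swap : ∀ y b z → y * (b * z) ≡ b * (y * z)
    swap = solve-∀

ballotPoly-closed : ∀ y n → + suc n * ballotPoly y n n
  ≡ sumℤ (map (λ k → + (suc k ℕ.* ((n ℕ.+ n ∸ k) C n)) * y ^ k) (upTo (suc n)))
ballotPoly-closed y n = begin
  + suc n * ballotPoly y n n
    ≡⟨ cong (+ suc n *_) (ballotPoly-expansion y n n) ⟩
  + suc n * ∑[ d < suc n ] (ballot n (n ∸ toℕ d) * y ^ toℕ d)
    ≡⟨ *-distribˡ-sum {suc n} (+ suc n) (λ d → ballot n (n ∸ toℕ d) * y ^ toℕ d) ⟩
  ∑[ d < suc n ] (+ suc n * (ballot n (n ∸ toℕ d) * y ^ toℕ d))
    ≡⟨ sum-cong-≗ {suc n} (λ d → term (ℕ.s≤s⁻¹ (Fin.toℕ<n d))) ⟩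
  ∑[ d < suc n ] (coefficient (toℕ d) * y ^ toℕ d)
    ≡⟨ sumℤ-map-applyUpTo (λ k → coefficient k * y ^ k) id (suc n) ⟨
  sumℤ (map (λ k → coefficient k * y ^ k) (upTo (suc n))) ∎
  where
    coefficient : ℕ → ℤ
    coefficient k = + (suc k ℕ.* ((n ℕ.+ n ∸ k) C n))
    term : ∀ {k} → k ≤ n → + suc n * (ballot n (n ∸ k) * y ^ k) ≡ coefficient k * y ^ k
    term {k} k≤n = begin
      + suc n * (ballot n (n ∸ k) * y ^ k)
        ≡⟨ ℤ.*-assoc (+ suc n) (ballot n (n ∸ k)) (y ^ k) ⟨
      + suc n * ballot n (n ∸ k) * y ^ k
        ≡⟨ cong (_* y ^ k) (ballot-closed (ℕ.m+[n∸m]≡n k≤n)) ⟩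
      + (suc k ℕ.* ((n ℕ.+ (n ∸ k)) C n)) * y ^ k
        ≡⟨ cong (λ z → + (suc k ℕ.* (z C n)) * y ^ k) (ℕ.+-∸-assoc n k≤n) ⟨
      coefficient k * y ^ k ∎

distinct⇒injective : ∀ {m n} {f : Fin m → Fin n} →
  (∀ {i j} → i Fin.< j → f i ≢ f j) → Injective _≡_ _≡_ f
distinct⇒injective distinct {i} {j} fi≡fj with Fin.<-cmp i j
... | tri< i<j _ _ = ⊥-elim (distinct i<j fi≡fj)
... | tri≈ _ i≡j _ = i≡j
... | tri> _ _ j<i = ⊥-elim (distinct j<i (sym fi≡fj))

injective⇒surjective : ∀ {n} {g : Fin n → Fin n} → Injective _≡_ _≡_ g → ∀ y → ∃ λ x → g x ≡ y
injective⇒surjective {suc n} {g} inj y with Fin.any? (λ x → g x Fin.≟ y)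
... | yes hit = hit
... | no miss = ⊥-elim (ℕ.1+n≰n (Fin.injective⇒≤ h-injective))
  where
    h : Fin (suc n) → Fin n
    h x = punchOut {i = y} {j = g x} (λ y≡gx → miss (x , sym y≡gx))
    h-injective : Injective _≡_ _≡_ h
    h-injective {x} {x′} hx≡hx′ = inj (Fin.punchOut-injective {i = y} {j = g x} {k = g x′} _ _ hx≡hx′)

-- With τ = g⁻¹, the pivot lemma for τ gives u ≤ g i ≤ τ u, and τ u ≤ i by hypothesis.
values-before⇒≤ : ∀ {n} {g : Fin n → Fin n} → Injective _≡_ _≡_ g →
  ∀ i → (∀ j → g j Fin.≤ g i → j Fin.≤ i) → g i Fin.≤ i
values-before⇒≤ {g = g} inj i before =
  ℕ.≤-trans gi≤τu (before (τ u) (subst (Fin._≤ g i) (sym (g∘τ u)) u≤gi))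
  where
    τ : _ → _
    τ y = proj₁ (injective⇒surjective inj y)
    g∘τ : ∀ y → g (τ y) ≡ y
    g∘τ y = proj₂ (injective⇒surjective inj y)
    τ-injective : Injective _≡_ _≡_ τ
    τ-injective {x} {y} τx≡τy = trans (sym (g∘τ x)) (trans (cong g τx≡τy) (g∘τ y))
    pivot = Fin.injective⇒existsPivot τ-injective (g i)
    u = proj₁ pivot
    u≤gi = proj₁ (proj₂ pivot)
    gi≤τu = proj₂ (proj₂ pivot)

toℕ-punchIn-below : ∀ {n} (b : Fin (suc n)) (y : Fin n) → toℕ y < toℕ b → toℕ (punchIn b y) ≡ toℕ y
toℕ-punchIn-below (suc b) zero    _         = refl
toℕ-punchIn-below (suc b) (suc y) (s≤s y<b) = cong suc (toℕ-punchIn-below b y y<b)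

toℕ-punchIn-above : ∀ {n} (b : Fin (suc n)) (y : Fin n) → toℕ b ≤ toℕ y → toℕ (punchIn b y) ≡ suc (toℕ y)
toℕ-punchIn-above zero    y       _         = refl
toℕ-punchIn-above (suc b) (suc y) (s≤s b≤y) = cong suc (toℕ-punchIn-above b y b≤y)

punchIn<⇒< : ∀ {n} (b : Fin (suc n)) (y : Fin n) → punchIn b y Fin.< b → y Fin.< b
punchIn<⇒< (suc b) zero    _        = s≤s z≤n
punchIn<⇒< (suc b) (suc y) (s≤s lt) = s≤s (punchIn<⇒< b y lt)

punchIn-mono-< : ∀ {n} (b : Fin (suc n)) {y z : Fin n} → y Fin.< z → punchIn b y Fin.< punchIn b z
punchIn-mono-< zero                    y<z       = s≤s y<z
punchIn-mono-< (suc b) {zero}  {suc z} _         = s≤s z≤n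
punchIn-mono-< (suc b) {suc y} {suc z} (s≤s y<z) = s≤s (punchIn-mono-< b y<z)

punchIn-cancel-< : ∀ {n} (b : Fin (suc n)) {y z : Fin n} → punchIn b y Fin.< punchIn b z → y Fin.< z
punchIn-cancel-< zero                    (s≤s y<z) = y<z
punchIn-cancel-< (suc b) {zero}  {suc z} _         = s≤s z≤n
punchIn-cancel-< (suc b) {suc y} {suc z} (s≤s y<z) = s≤s (punchIn-cancel-< b y<z)

T-does : ∀ {A : Set} (a? : Dec A) → T (does a?) ⇔ A
T-does (yes a) = mk⇔ (const a) (const _)
T-does (no ¬a) = mk⇔ (λ ()) ¬a

any-allFin⁻ : ∀ {n} (p : Fin n → Bool) → T (any p (allFin n)) → ∃ λ i → T (p i)
any-allFin⁻ p = Any.tabulate⁻ ∘ Any.any⁻ p (allFin _)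

any-allFin⁺ : ∀ {n} (p : Fin n → Bool) i → T (p i) → T (any p (allFin n))
any-allFin⁺ p i = Any.any⁺ p ∘ Any.tabulate⁺ i

all-allFin⁻ : ∀ {n} (p : Fin n → Bool) → T (all p (allFin n)) → ∀ i → T (p i)
all-allFin⁻ p = All.tabulate⁻ ∘ All.all⁺ p (allFin _)

all-allFin⁺ : ∀ {n} (p : Fin n → Bool) → (∀ i → T (p i)) → T (all p (allFin n))
all-allFin⁺ p = All.all⁻ p ∘ All.tabulate⁺

Pattern321 : ∀ {m n} → (Fin m → Fin n) → Set
Pattern321 f = ∃ λ i → ∃ λ j → ∃ λ l → i Fin.< j × j Fin.< l × f j Fin.< f i × f l Fin.< f j

InversionBelow : ∀ {m n} → ℕ → (Fin m → Fin n) → Set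
InversionBelow t f = ∃ λ i → ∃ λ j → i Fin.< j × f j Fin.< f i × toℕ (f i) < t

Admissible : ∀ {m n} → ℕ → (Fin m → Fin n) → Set
Admissible t f = Injective _≡_ _≡_ f × ¬ Pattern321 f × ¬ InversionBelow t f

¬InversionBelow-zero : ∀ {m n} {f : Fin m → Fin n} → ¬ InversionBelow 0 f
¬InversionBelow-zero (_ , _ , _ , _ , ())

hasInversionBelow : ∀ {n} → ℕ → Vec (Fin n) n → Bool
hasInversionBelow {n} t π = any (λ i → any (λ j →
  (toℕ i <ᵇ toℕ j) ∧ (val π j <ᵇ val π i) ∧ (val π i <ᵇ t)) (allFin n)) (allFin n)

admissible : ∀ {n} → ℕ → Vec (Fin n) n → Bool
admissible t π = isPerm π ∧ not (has321 π) ∧ not (hasInversionBelow t π)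

module _ {n} (π : Vec (Fin n) n) where

  private
    f = lookup π

    distinct? : ∀ i j → Dec (¬ (i Fin.< j × toℕ (f i) ≡ toℕ (f j)))
    distinct? i j = ¬? (i Fin.<? j ×-dec toℕ (f i) ℕ.≟ toℕ (f j))

    pattern321? : ∀ i j l → Dec (i Fin.< j × j Fin.< l × f j Fin.< f i × f l Fin.< f j)
    pattern321? i j l = i Fin.<? j ×-dec j Fin.<? l ×-dec f j Fin.<? f i ×-dec f l Fin.<? f j

    inversionBelow? : ∀ t i j → Dec (i Fin.< j × f j Fin.< f i × toℕ (f i) < t)
    inversionBelow? t i j = i Fin.<? j ×-dec f j Fin.<? f i ×-dec toℕ (f i) ℕ.<? t

  isPerm⇒injective : T (isPerm π) → Injective _≡_ _≡_ f
  isPerm⇒injective perm = distinct⇒injective λ {i} {j} i<j fi≡fj →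
    Equivalence.to (T-does (distinct? i j)) (all-allFin⁻ _ (all-allFin⁻ _ perm i) j) (i<j , cong toℕ fi≡fj)

  injective⇒isPerm : Injective _≡_ _≡_ f → T (isPerm π)
  injective⇒isPerm inj = all-allFin⁺ _ λ i → all-allFin⁺ _ λ j →
    Equivalence.from (T-does (distinct? i j)) λ (i<j , fi≡fj) → Fin.<-irrefl (inj (Fin.toℕ-injective fi≡fj)) i<j

  has321⇒Pattern321 : T (has321 π) → Pattern321 f
  has321⇒Pattern321 h =
    let i , h = any-allFin⁻ _ h
        j , h = any-allFin⁻ _ h
        l , h = any-allFin⁻ _ h
    in i , j , l , Equivalence.to (T-does (pattern321? i j l)) h

  Pattern321⇒has321 : Pattern321 f → T (has321 π)
  Pattern321⇒has321 (i , j , l , p) =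
    any-allFin⁺ _ i (any-allFin⁺ _ j (any-allFin⁺ _ l (Equivalence.from (T-does (pattern321? i j l)) p)))

  hasInversionBelow⇒InversionBelow : ∀ t → T (hasInversionBelow t π) → InversionBelow t f
  hasInversionBelow⇒InversionBelow t h =
    let i , h = any-allFin⁻ _ h
        j , h = any-allFin⁻ _ h
    in i , j , Equivalence.to (T-does (inversionBelow? t i j)) h

  InversionBelow⇒hasInversionBelow : ∀ t → InversionBelow t f → T (hasInversionBelow t π)
  InversionBelow⇒hasInversionBelow t (i , j , p) =
    any-allFin⁺ _ i (any-allFin⁺ _ j (Equivalence.from (T-does (inversionBelow? t i j)) p))

  admissible⇔Admissible : ∀ t → T (admissible t π) ⇔ Admissible t f
  admissible⇔Admissible t = mk⇔
    (λ h → let perm , no321 , noInv = Equivalence.to (T-does conjuncts) h in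
      (λ {_} {_} → isPerm⇒injective perm) , no321 ∘ Pattern321⇒has321 ,
      noInv ∘ InversionBelow⇒hasInversionBelow t)
    (λ (inj , no321 , noInv) → Equivalence.from (T-does conjuncts)
      (injective⇒isPerm inj , no321 ∘ has321⇒Pattern321 , noInv ∘ hasInversionBelow⇒InversionBelow t))
    where
      conjuncts = T? (isPerm π) ×-dec ¬? (T? (has321 π)) ×-dec ¬? (T? (hasInversionBelow t π))

hasInversionBelow-zero : ∀ {n} (π : Vec (Fin n) n) → hasInversionBelow 0 π ≡ false
hasInversionBelow-zero π with hasInversionBelow 0 π | hasInversionBelow⇒InversionBelow π 0
... | true  | inversion = ⊥-elim (¬InversionBelow-zero (inversion _))
... | false | _         = refl

count : ∀ {n} → (Fin n → Bool) → ℕ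
count {zero}  p = 0
count {suc n} p = (if p zero then 1 else 0) ℕ.+ count (p ∘ suc)

count-cong : ∀ {n} {p q : Fin n → Bool} → (∀ i → p i ≡ q i) → count p ≡ count q
count-cong {zero}  p≗q = refl
count-cong {suc n} p≗q = cong₂ (λ b k → (if b then 1 else 0) ℕ.+ k) (p≗q zero) (count-cong (p≗q ∘ suc))

length-filterᵇ-tabulate : ∀ {A : Set} {n} (p : A → Bool) (f : Fin n → A) →
  List.length (filterᵇ p (tabulate f)) ≡ count (p ∘ f)
length-filterᵇ-tabulate {n = zero}  p f = refl
length-filterᵇ-tabulate {n = suc n} p f with p (f zero)
... | true  = cong suc (length-filterᵇ-tabulate p (f ∘ suc))
... | false = length-filterᵇ-tabulate p (f ∘ suc)

FixedFrom : ∀ {m n} → ℕ → (Fin m → Fin n) → Fin m → Set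
FixedFrom t f i = toℕ (f i) ≡ toℕ i × t ≤ toℕ i

FixedFrom? : ∀ {m n} t (f : Fin m → Fin n) i → Dec (FixedFrom t f i)
FixedFrom? t f i = toℕ (f i) ℕ.≟ toℕ i ×-dec t ℕ.≤? toℕ i

fixedFrom : ∀ {m n} → ℕ → (Fin m → Fin n) → ℕ
fixedFrom t f = count (does ∘ FixedFrom? t f)

count-⇔ : ∀ {n} {P Q : Fin n → Set} (P? : ∀ i → Dec (P i)) (Q? : ∀ i → Dec (Q i)) →
  (∀ i → P i ⇔ Q i) → count (does ∘ P?) ≡ count (does ∘ Q?)
count-⇔ P? Q? P⇔Q = count-cong λ i → does-⇔ (P⇔Q i) (P? i) (Q? i)

fix≡fixedFrom0 : ∀ {n} (π : Vec (Fin n) n) → fix π ≡ fixedFrom 0 (lookup π)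
fix≡fixedFrom0 π = trans (length-filterᵇ-tabulate (λ i → val π i ≡ᵇ toℕ i) id)
  (count-cong λ i → sym (∧-identityʳ (val π i ≡ᵇ toℕ i)))

prepend : ∀ {m n} → Fin (suc n) → (Fin m → Fin n) → Fin (suc m) → Fin (suc n)
prepend b g zero    = b
prepend b g (suc i) = punchIn b (g i)

module _ {m n} (b : Fin (suc n)) {g : Fin m → Fin n} where

  prepend-injective⁻ : Injective _≡_ _≡_ (prepend b g) → Injective _≡_ _≡_ g
  prepend-injective⁻ inj gi≡gj = Fin.suc-injective (inj (cong (punchIn b) gi≡gj))

  prepend-injective⁺ : Injective _≡_ _≡_ g → Injective _≡_ _≡_ (prepend b g)
  prepend-injective⁺ inj {zero}  {zero}  _     = refl
  prepend-injective⁺ inj {zero}  {suc j} b≡    = ⊥-elim (Fin.punchInᵢ≢i b (g j) (sym b≡))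
  prepend-injective⁺ inj {suc i} {zero}  ≡b    = ⊥-elim (Fin.punchInᵢ≢i b (g i) ≡b)
  prepend-injective⁺ inj {suc i} {suc j} gi≡gj = cong suc (inj (Fin.punchIn-injective b (g i) (g j) gi≡gj))

  Pattern321-prepend⁻ : Pattern321 (prepend b g) → Pattern321 g ⊎ InversionBelow (toℕ b) g
  Pattern321-prepend⁻ (zero , suc j , suc l , _ , s≤s j<l , gj<b , gl<gj) =
    inj₂ (j , l , j<l , punchIn-cancel-< b gl<gj , punchIn<⇒< b (g j) gj<b)
  Pattern321-prepend⁻ (suc i , suc j , suc l , s≤s i<j , s≤s j<l , gj<gi , gl<gj) =
    inj₁ (i , j , l , i<j , j<l , punchIn-cancel-< b gj<gi , punchIn-cancel-< b gl<gj)

  Pattern321-prepend⁺ : Pattern321 g ⊎ InversionBelow (toℕ b) g → Pattern321 (prepend b g)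
  Pattern321-prepend⁺ (inj₁ (i , j , l , i<j , j<l , gj<gi , gl<gj)) =
    suc i , suc j , suc l , s≤s i<j , s≤s j<l , punchIn-mono-< b gj<gi , punchIn-mono-< b gl<gj
  Pattern321-prepend⁺ (inj₂ (j , l , j<l , gl<gj , gj<b)) =
    zero , suc j , suc l , s≤s z≤n , s≤s j<l ,
    subst (_< toℕ b) (sym (toℕ-punchIn-below b (g j) gj<b)) gj<b , punchIn-mono-< b gl<gj

  InversionBelow-prepend⁻ : ∀ {t} → t ≤ toℕ b → InversionBelow t (prepend b g) → InversionBelow (toℕ b) g
  InversionBelow-prepend⁻ t≤b (zero , suc j , _ , _ , b<t) = ⊥-elim (ℕ.<-irrefl refl (ℕ.<-≤-trans b<t t≤b))
  InversionBelow-prepend⁻ t≤b (suc i , suc j , s≤s i<j , gj<gi , gi<t) =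
    i , j , i<j , punchIn-cancel-< b gj<gi , punchIn<⇒< b (g i) (ℕ.<-≤-trans gi<t t≤b)

  Admissible-prepend : ∀ {t} → t ≤ toℕ b → Admissible t (prepend b g) ⇔ Admissible (toℕ b) g
  Admissible-prepend t≤b = mk⇔
    (λ (inj , no321 , _) →
      (λ {_} {_} → prepend-injective⁻ inj) , no321 ∘ Pattern321-prepend⁺ ∘ inj₁ ,
      no321 ∘ Pattern321-prepend⁺ ∘ inj₂)
    (λ (inj , no321 , noInv) →
      (λ {_} {_} → prepend-injective⁺ inj) , [ no321 , noInv ] ∘ Pattern321-prepend⁻ ,
      noInv ∘ InversionBelow-prepend⁻ t≤b)

module _ {m n} {g : Fin m → Fin n} where

  InversionBelow-prepend-zero⁻ : ∀ {t} → InversionBelow (suc t) (prepend zero g) → InversionBelow t g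
  InversionBelow-prepend-zero⁻ (suc i , suc j , s≤s i<j , s≤s gj<gi , s≤s gi<t) = i , j , i<j , gj<gi , gi<t

  InversionBelow-prepend-zero⁺ : ∀ {t} → InversionBelow t g → InversionBelow (suc t) (prepend zero g)
  InversionBelow-prepend-zero⁺ (i , j , i<j , gj<gi , gi<t) = suc i , suc j , s≤s i<j , s≤s gj<gi , s≤s gi<t

  Admissible-prepend-zero : ∀ {t} → Admissible (suc t) (prepend zero g) ⇔ Admissible t g
  Admissible-prepend-zero = mk⇔
    (λ (inj , no321 , noInv) →
      (λ {_} {_} → prepend-injective⁻ zero inj) , no321 ∘ Pattern321-prepend⁺ zero ∘ inj₁ ,
      noInv ∘ InversionBelow-prepend-zero⁺)
    (λ (inj , no321 , noInv) →
      (λ {_} {_} → prepend-injective⁺ zero inj) , [ no321 , ¬InversionBelow-zero ] ∘ Pattern321-prepend⁻ zero ,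
      noInv ∘ InversionBelow-prepend-zero⁻)

  fixedFrom-prepend-zero : ∀ {t} → fixedFrom (suc t) (prepend zero g) ≡ fixedFrom t g
  fixedFrom-prepend-zero {t} = count-⇔ (FixedFrom? (suc t) (prepend zero g) ∘ suc) (FixedFrom? t g) λ i → mk⇔
    (λ (e , le) → ℕ.suc-injective e , ℕ.s≤s⁻¹ le)
    (λ (e , le) → cong suc e , s≤s le)

  -- punchIn b does not move the letters below b, so such a letter of g becomes a fixed point of
  -- prepend b g only if it lies just above the diagonal of g, which the hypothesis excludes.
  fixedFrom-prepend-suc : ∀ {t} {c : Fin n} → t ≤ suc (toℕ c) →
    (∀ i → toℕ (g i) < suc (toℕ c) → toℕ (g i) ≤ toℕ i) →
    fixedFrom t (prepend (suc c) g) ≡ fixedFrom (suc (toℕ c)) g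
  fixedFrom-prepend-suc {t} {c} t≤b below =
    count-⇔ (FixedFrom? t (prepend b g) ∘ suc) (FixedFrom? (toℕ b) g) λ i → mk⇔ (to i) (from i)
    where
      b = suc c
      to : ∀ i → FixedFrom t (prepend b g) (suc i) → FixedFrom (toℕ b) g i
      to i (e , _) with toℕ (g i) ℕ.<? toℕ b
      ... | yes gi<b = ⊥-elim (ℕ.1+n≰n (subst (ℕ._≤ toℕ i) gi≡1+i (below i gi<b)))
        where gi≡1+i = trans (sym (toℕ-punchIn-below b (g i) gi<b)) e
      ... | no gi≮b = gi≡i , subst (toℕ b ≤_) gi≡i b≤gi
        where
          b≤gi = ℕ.≮⇒≥ gi≮b
          gi≡i = ℕ.suc-injective (trans (sym (toℕ-punchIn-above b (g i) b≤gi)) e)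
      from : ∀ i → FixedFrom (toℕ b) g i → FixedFrom t (prepend b g) (suc i)
      from i (gi≡i , b≤i) =
        trans (toℕ-punchIn-above b (g i) (subst (toℕ b ≤_) (sym gi≡i) b≤i)) (cong suc gi≡i) ,
        ℕ.≤-trans t≤b (ℕ.≤-trans b≤i (ℕ.n≤1+n _))

below-diagonal : ∀ {n t} {g : Fin n → Fin n} → Injective _≡_ _≡_ g → ¬ InversionBelow t g →
  ∀ i → toℕ (g i) < t → toℕ (g i) ≤ toℕ i
below-diagonal inj noInv i gi<t = values-before⇒≤ inj i λ j gj≤gi → ℕ.≮⇒≥ λ i<j →
  noInv (i , j , i<j , ℕ.≤∧≢⇒< gj≤gi (λ gj≡gi → Fin.<-irrefl (inj (Fin.toℕ-injective (sym gj≡gi))) i<j) ,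
         gi<t)

¬Admissible-prepend-high : ∀ {m t} {c : Fin m} {g : Fin m → Fin m} →
  suc (toℕ c) < t → ¬ Admissible t (prepend (suc c) g)
¬Admissible-prepend-high {suc m} {c = c} c<t (inj , _ , noInv) =
  let j , gj≡0 = injective⇒surjective (prepend-injective⁻ (suc c) inj) zero
  in noInv (zero , suc j , s≤s z≤n , subst (λ v → punchIn (suc c) v Fin.< suc c) (sym gj≡0) (s≤s z≤n) , c<t)

Admissible-resp : ∀ {m n t} {f f′ : Fin m → Fin n} → f ≗ f′ → Admissible t f → Admissible t f′
Admissible-resp {t = t} {f} {f′} f≗f′ (inj , no321 , noInv) =
  (λ {_} {_} e → inj (trans (f≗f′ _) (trans e (sym (f≗f′ _))))) ,
  (λ (i , j , l , i<j , j<l , fj<fi , fl<fj) →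
    no321 (i , j , l , i<j , j<l , resp< j i fj<fi , resp< l j fl<fj)) ,
  (λ (i , j , i<j , fj<fi , fi<t) →
    noInv (i , j , i<j , resp< j i fj<fi , subst (_< t) (sym (cong toℕ (f≗f′ i))) fi<t))
  where
    resp< : ∀ i j → f′ i Fin.< f′ j → f i Fin.< f j
    resp< i j = subst₂ (λ u v → u Fin.< v) (sym (f≗f′ i)) (sym (f≗f′ j))

Admissible-cong : ∀ {m n t} {f f′ : Fin m → Fin n} → f ≗ f′ → Admissible t f ⇔ Admissible t f′
Admissible-cong f≗f′ = mk⇔ (Admissible-resp f≗f′) (Admissible-resp (sym ∘ f≗f′))

fixedFrom-cong : ∀ {m n t} {f f′ : Fin m → Fin n} → f ≗ f′ → fixedFrom t f ≡ fixedFrom t f′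
fixedFrom-cong {t = t} f≗f′ =
  count-cong λ i → cong (λ v → does (toℕ v ℕ.≟ toℕ i ×-dec t ℕ.≤? toℕ i)) (f≗f′ i)

infixr 5 _◃_
_◃_ : ∀ {m n} → Fin (suc m) → Vec (Fin m) n → Vec (Fin (suc m)) (suc n)
b ◃ σ = b ∷ Vec.map (punchIn b) σ

lookup-◃ : ∀ {m n} (b : Fin (suc m)) (σ : Vec (Fin m) n) → lookup (b ◃ σ) ≗ prepend b (lookup σ)
lookup-◃ b σ zero    = refl
lookup-◃ b σ (suc i) = Vec.lookup-map i (punchIn b) σ

weight : ∀ {n} → ℤ → ℕ → Vec (Fin n) n → ℤ
weight x t π = if admissible t π then x ^ fixedFrom t (lookup π) else + 0

module _ (x : ℤ) where

  weight-≡0 : ∀ {n t} {π : Vec (Fin n) n} → ¬ Admissible t (lookup π) → weight x t π ≡ + 0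
  weight-≡0 {t = t} {π} ¬adm with admissible t π | Equivalence.to (admissible⇔Admissible π t)
  ... | true  | adm = ⊥-elim (¬adm (adm _))
  ... | false | _   = refl

  weight-≡ : ∀ {m n t t′} {π : Vec (Fin m) m} {π′ : Vec (Fin n) n} {u} →
    Admissible t (lookup π) ⇔ Admissible t′ (lookup π′) →
    (Admissible t′ (lookup π′) → x ^ fixedFrom t (lookup π) ≡ u) →
    weight x t π ≡ (if admissible t′ π′ then u else + 0)
  weight-≡ {t = t} {t′} {π} {π′} A⇔A′ power≡ =
    trans (cong (λ b → if b then x ^ fixedFrom t (lookup π) else + 0) same-admissibility) choose
    where
      same-admissibility : admissible t π ≡ admissible t′ π′
      same-admissibility = does-⇔
        (⇔-sym (admissible⇔Admissible π′ t′) ⇔-∘ (A⇔A′ ⇔-∘ admissible⇔Admissible π t))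
        (T? (admissible t π)) (T? (admissible t′ π′))
      choose : (if admissible t′ π′ then x ^ fixedFrom t (lookup π) else + 0)
             ≡ (if admissible t′ π′ then _ else + 0)
      choose with admissible t′ π′ | Equivalence.to (admissible⇔Admissible π′ t′)
      ... | true  | adm = power≡ (adm _)
      ... | false | _   = refl

  weight-repeated : ∀ {m t} {b : Fin (suc m)} {w : Vec (Fin (suc m)) m} i →
    lookup w i ≡ b → weight x t (b ∷ w) ≡ + 0
  weight-repeated {t = t} {b} {w} i wi≡b =
    weight-≡0 {t = t} {π = b ∷ w} λ (inj , _) → Fin.0≢1+n (inj (sym wi≡b))

  weight-zero◃₀ : ∀ {m} (σ : Vec (Fin m) m) → weight x 0 (zero ◃ σ) ≡ x * weight x 0 σ
  weight-zero◃₀ σ = trans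
    (weight-≡ {t = 0} {0} {zero ◃ σ} {σ} (Admissible-prepend zero z≤n ⇔-∘ Admissible-cong (lookup-◃ zero σ))
              -- fixedFrom 0 (prepend zero g) computes to suc (fixedFrom 0 g): position 0 is fixed.
              (λ _ → cong (x ^_) (fixedFrom-cong {t = 0} (lookup-◃ zero σ))))
    (*-if (admissible 0 σ))
    where
      *-if : ∀ b {u} → (if b then x * u else + 0) ≡ x * (if b then u else + 0)
      *-if true  = refl
      *-if false = sym (ℤ.*-zeroʳ x)

  weight-zero◃ : ∀ {m t} (σ : Vec (Fin m) m) → weight x (suc t) (zero ◃ σ) ≡ weight x t σ
  weight-zero◃ {t = t} σ = weight-≡ {t = suc t} {t} {zero ◃ σ} {σ}
    (Admissible-prepend-zero ⇔-∘ Admissible-cong (lookup-◃ zero σ))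
    (λ _ → cong (x ^_) (trans (fixedFrom-cong {t = suc t} (lookup-◃ zero σ))
                              (fixedFrom-prepend-zero {g = lookup σ} {t})))

  weight-suc◃-low : ∀ {m t} {c : Fin m} (σ : Vec (Fin m) m) → t ≤ suc (toℕ c) →
    weight x t (suc c ◃ σ) ≡ weight x (suc (toℕ c)) σ
  weight-suc◃-low {t = t} {c} σ t≤b = weight-≡ {t = t} {suc (toℕ c)} {suc c ◃ σ} {σ}
    (Admissible-prepend (suc c) t≤b ⇔-∘ Admissible-cong (lookup-◃ (suc c) σ))
    (λ (inj , _ , noInv) → cong (x ^_) (trans (fixedFrom-cong {t = t} (lookup-◃ (suc c) σ))
      (fixedFrom-prepend-suc t≤b (below-diagonal inj noInv))))

  weight-suc◃-high : ∀ {m t} {c : Fin m} (σ : Vec (Fin m) m) → suc (toℕ c) < t →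
    weight x t (suc c ◃ σ) ≡ + 0
  weight-suc◃-high {t = t} {c} σ b<t =
    weight-≡0 {t = t} {π = suc c ◃ σ} (¬Admissible-prepend-high b<t ∘ Admissible-resp (lookup-◃ (suc c) σ))

Σ-vecs : (m n : ℕ) → (Vec (Fin m) n → ℤ) → ℤ
Σ-vecs m n g = sumℤ (map g (allVecs m n))

Σ-vecs-cong : ∀ {m n} {g h : Vec (Fin m) n → ℤ} → g ≗ h → Σ-vecs m n g ≡ Σ-vecs m n h
Σ-vecs-cong {m} {n} g≗h = cong sumℤ (List.map-cong g≗h (allVecs m n))

Σ-vecs-∷ : ∀ m n (g : Vec (Fin m) (suc n) → ℤ) → Σ-vecs m (suc n) g ≡ ∑[ b < m ] Σ-vecs m n (g ∘ (b ∷_))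
Σ-vecs-∷ m n g = begin
  sumℤ (map g (concatMap (λ b → map (b ∷_) (allVecs m n)) (allFin m)))
    ≡⟨ sumℤ-map-concatMap g (λ b → map (b ∷_) (allVecs m n)) (allFin m) ⟩
  sumℤ (map (λ b → sumℤ (map g (map (b ∷_) (allVecs m n)))) (allFin m))
    ≡⟨ cong sumℤ (List.map-cong (λ b → cong sumℤ (sym (List.map-∘ (allVecs m n)))) (allFin m)) ⟩
  sumℤ (map (λ b → Σ-vecs m n (g ∘ (b ∷_))) (allFin m))
    ≡⟨ sumℤ-map-tabulate (λ b → Σ-vecs m n (g ∘ (b ∷_))) id ⟩
  ∑[ b < m ] Σ-vecs m n (g ∘ (b ∷_)) ∎

Σ-vecs-punchIn : ∀ {m} n (b : Fin (suc m)) (g : Vec (Fin (suc m)) n → ℤ) →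
  (∀ w i → lookup w i ≡ b → g w ≡ + 0) → Σ-vecs (suc m) n g ≡ Σ-vecs m n (g ∘ Vec.map (punchIn b))
Σ-vecs-punchIn zero b g _ = refl
Σ-vecs-punchIn {m} (suc n) b g vanish = begin
  Σ-vecs (suc m) (suc n) g
    ≡⟨ Σ-vecs-∷ (suc m) n g ⟩
  ∑[ c < suc m ] Σ-vecs (suc m) n (g ∘ (c ∷_))
    ≡⟨ sum-remove {i = b} (λ c → Σ-vecs (suc m) n (g ∘ (c ∷_))) ⟩
  Σ-vecs (suc m) n (g ∘ (b ∷_)) + ∑[ c < m ] Σ-vecs (suc m) n (g ∘ (punchIn b c ∷_))
    ≡⟨ cong (_+ rest) (sumℤ-map-zero (allVecs (suc m) n) (λ w → vanish (b ∷ w) zero refl)) ⟩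
  + 0 + ∑[ c < m ] Σ-vecs (suc m) n (g ∘ (punchIn b c ∷_))
    ≡⟨ ℤ.+-identityˡ rest ⟩
  ∑[ c < m ] Σ-vecs (suc m) n (g ∘ (punchIn b c ∷_))
    ≡⟨ sum-cong-≗ {m} (λ c →
         Σ-vecs-punchIn n b (g ∘ (punchIn b c ∷_)) (λ w i → vanish (punchIn b c ∷ w) (suc i))) ⟩
  ∑[ c < m ] Σ-vecs m n (λ σ → g (punchIn b c ∷ Vec.map (punchIn b) σ))
    ≡⟨ Σ-vecs-∷ m n (g ∘ Vec.map (punchIn b)) ⟨
  Σ-vecs m (suc n) (g ∘ Vec.map (punchIn b)) ∎
  where rest = ∑[ c < m ] Σ-vecs (suc m) n (g ∘ (punchIn b c ∷_))

sumFrom : ℕ → ℕ → (ℕ → ℤ) → ℤ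
sumFrom m t g = ∑[ c < m ] (if does (toℕ c ℕ.<? t) then + 0 else g (toℕ c))

sumFrom-step : ∀ {m t} (g : ℕ → ℤ) → t < m → sumFrom m t g ≡ g t + sumFrom m (suc t) g
sumFrom-step {suc m} {zero}  g _         = cong (_+_ (g 0)) (sym (ℤ.+-identityˡ _))
sumFrom-step {suc m} {suc t} g (s≤s t<m) = begin
  + 0 + sumFrom m t (g ∘ suc)                    ≡⟨ ℤ.+-identityˡ _ ⟩
  sumFrom m t (g ∘ suc)                          ≡⟨ sumFrom-step (g ∘ suc) t<m ⟩
  g (suc t) + sumFrom m (suc t) (g ∘ suc)        ≡⟨ cong (_+_ (g (suc t))) (ℤ.+-identityˡ _) ⟨
  g (suc t) + (+ 0 + sumFrom m (suc t) (g ∘ suc)) ∎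

sumFrom-empty : ∀ m (g : ℕ → ℤ) → sumFrom m m g ≡ + 0
sumFrom-empty zero    g = refl
sumFrom-empty (suc m) g = trans (ℤ.+-identityˡ _) (sumFrom-empty m (g ∘ suc))

aₜ : ℕ → ℕ → ℤ → ℤ
aₜ t n x = Σ-vecs n n (weight x t)

module _ (x : ℤ) where

  aₜ-first-letter : ∀ t m → aₜ t (suc m) x ≡ ∑[ b < suc m ] Σ-vecs m m (λ σ → weight x t (b ◃ σ))
  aₜ-first-letter t m = trans (Σ-vecs-∷ (suc m) m (weight x t)) (sum-cong-≗ {suc m} λ b →
    Σ-vecs-punchIn m b (weight x t ∘ (b ∷_)) (λ w i → weight-repeated x {t = t} i))

  aₜ-suc₀ : ∀ m → aₜ 0 (suc m) x ≡ x * aₜ 0 m x + sumFrom m 0 (λ k → aₜ (suc k) m x)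
  aₜ-suc₀ m = trans (aₜ-first-letter 0 m) (cong₂ _+_
    (trans (Σ-vecs-cong {m} {m} (weight-zero◃₀ x)) (sumℤ-map-scale x (weight x 0) (allVecs m m)))
    (sum-cong-≗ {m} λ c → Σ-vecs-cong {m} {m} λ σ → weight-suc◃-low x {t = 0} {c} σ z≤n))

  aₜ-suc : ∀ t m → aₜ (suc t) (suc m) x ≡ aₜ t m x + sumFrom m t (λ k → aₜ (suc k) m x)
  aₜ-suc t m = trans (aₜ-first-letter (suc t) m)
    (cong₂ _+_ (Σ-vecs-cong {m} {m} (weight-zero◃ x {t = t})) (sum-cong-≗ {m} later-letter))
    where
      later-letter : ∀ c → Σ-vecs m m (λ σ → weight x (suc t) (suc c ◃ σ))
                         ≡ (if does (toℕ c ℕ.<? t) then + 0 else aₜ (suc (toℕ c)) m x)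
      later-letter c = by-cases (toℕ c ℕ.<? t)
        where
          by-cases : (c<t? : Dec (toℕ c < t)) → Σ-vecs m m (λ σ → weight x (suc t) (suc c ◃ σ))
                       ≡ (if does c<t? then + 0 else aₜ (suc (toℕ c)) m x)
          by-cases (yes c<t) = sumℤ-map-zero (allVecs m m) λ σ → weight-suc◃-high x σ (s≤s c<t)
          by-cases (no c≮t)  = Σ-vecs-cong λ σ → weight-suc◃-low x σ (s≤s (ℕ.≮⇒≥ c≮t))

  aₜ-diag : ∀ m → aₜ m m x ≡ + 1
  aₜ-diag zero    = refl
  aₜ-diag (suc m) = begin
    aₜ (suc m) (suc m) x  ≡⟨ aₜ-suc m m ⟩
    aₜ m m x + S          ≡⟨ cong₂ _+_ (aₜ-diag m) (sumFrom-empty m G) ⟩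
    + 1                   ∎
    where
      G = λ k → aₜ (suc k) m x
      S = sumFrom m m G

  aₜ-rec₀ : ∀ m → aₜ 0 (suc m) x ≡ aₜ 1 (suc m) x + (x - + 1) * aₜ 0 m x
  aₜ-rec₀ m = begin
    aₜ 0 (suc m) x                      ≡⟨ aₜ-suc₀ m ⟩
    x * aₜ 0 m x + S                    ≡⟨ regroup x (aₜ 0 m x) S ⟩
    (aₜ 0 m x + S) + (x - + 1) * aₜ 0 m x ≡⟨ cong (_+ (x - + 1) * aₜ 0 m x) (aₜ-suc 0 m) ⟨
    aₜ 1 (suc m) x + (x - + 1) * aₜ 0 m x ∎
    where
      S = sumFrom m 0 (λ k → aₜ (suc k) m x)
      regroup : ∀ x a s → x * a + s ≡ (a + s) + (x - + 1) * a
      regroup = solve-∀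

  aₜ-rec : ∀ {m t} → t < m → aₜ (suc t) (suc m) x ≡ aₜ (suc (suc t)) (suc m) x + aₜ t m x
  aₜ-rec {m} {t} t<m = begin
    aₜ (suc t) (suc m) x                                    ≡⟨ aₜ-suc t m ⟩
    aₜ t m x + sumFrom m t G                                ≡⟨ cong (_+_ (aₜ t m x)) (sumFrom-step G t<m) ⟩
    aₜ t m x + (aₜ (suc t) m x + sumFrom m (suc t) G)       ≡⟨ ℤ.+-comm (aₜ t m x) _ ⟩
    (aₜ (suc t) m x + sumFrom m (suc t) G) + aₜ t m x       ≡⟨ cong (_+ aₜ t m x) (aₜ-suc (suc t) m) ⟨
    aₜ (suc (suc t)) (suc m) x + aₜ t m x                   ∎
    where
      G = λ k → aₜ (suc k) m x

aₜ₀ballotPoly-unique : ∀ x n → aₜ 0 n x ≡ ballotPoly (x - + 1) n n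
aₜ₀ballotPoly-unique x n =
  ballotPoly-unique (x - + 1) (λ m t → aₜ t m x) (aₜ-diag x) (aₜ-rec₀ x) (aₜ-rec x) n n 0 refl

a≡aₜ₀ : ∀ n x → a n x ≡ aₜ 0 n x
a≡aₜ₀ n x = trans (sumℤ-map-filterᵇ _ (λ π → x ^ fix π) (allVecs n n)) (Σ-vecs-cong {n} {n} λ π →
  cong₂ (λ b k → if b then x ^ k else + 0) (sym (admissible₀ π)) (fix≡fixedFrom0 π))
  where
    admissible₀ : ∀ π → admissible 0 π ≡ isPerm π ∧ not (has321 π)
    admissible₀ π rewrite hasInversionBelow-zero π = cong (isPerm π ∧_) (∧-identityʳ (not (has321 π)))

lemma7p4 : (n : ℕ) → 1 ≤ n → (x : ℤ) →
    (+ (suc n)) * a n x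
      ≡ sumℤ (map (λ k → (+ (suc k Data.Nat.* ((n Data.Nat.+ n ∸ k) C n))) * ((x - + 1) ^ k)) (upTo (suc n)))
lemma7p4 n _ x = begin
  + suc n * a n x                     ≡⟨ cong (+ suc n *_) (a≡aₜ₀ n x) ⟩
  + suc n * aₜ 0 n x                  ≡⟨ cong (+ suc n *_) (aₜ₀ballotPoly-unique x n) ⟩
  + suc n * ballotPoly (x - + 1) n n  ≡⟨ ballotPoly-closed (x - + 1) n ⟩
  sumℤ (map (λ k → + (suc k ℕ.* ((n ℕ.+ n ∸ k) C n)) * (x - + 1) ^ k) (upTo (suc n))) ∎
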